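{- If there exists $I \in \mathcal D$ such that $1 \notin I$, then $p_1 = 2$; moreover, if in addition $I \in \mathcal P_{n-1}(S_n)$, then $\alpha_1 \ge 4$.
   Context: Standing setting: $n \ge 3$ is an integer, $S_n = \{1,\ldots,n\}$; for a set $X$, $\mathcal P_\star(X)$ is the family of finite nonempty proper subsets of $X$ and $\mathcal P_k(X)$ the family of $k$-element subsets. Let $p_1 < p_2 < \cdots < p_n$ be primes, $\mathfrak P = \{p_1,\ldots,p_n\}$, $v_1,\ldots,v_n$ positive integers, $\mathcal D$ a nonempty subfamily of $\mathcal P_\star(S_n)$, and $\varepsilon:\mathcal P_\star(S_n)\to\{\pm1\}$ a map, with $\varepsilon_I := \varepsilon(I)$. Standing hypothesis: every prime $q$ dividing $\prod_{i\in I} p_i^{v_i} - \varepsilon_I$ for some $I \in \mathcal D$ belongs to $\mathfrak P$. Notation: $\mathcal D^{\mathrm{op}} := \{S_n\setminus I : I \in \mathcal D\}$; for $I \in \mathcal P_\star(S_n)$, $P_I := \prod_{i\in I} p_i^{v_i}$, $P_{ -I} := P_{S_n\setminus I}$, $\varepsilon_{ -I} := \varepsilon_{S_n\setminus I}$; for $i\in S_n$, $P_{ -i} := P_{ -\{i\}}$, $\varepsilon_{ -i} := \varepsilon_{ -\{i\}}$. For $I \in \mathcal D^{\mathrm{op}}$ and $i\in I$, $\alpha_{i,I}$ denotes the exponent of $p_i$ in the positive integer $P_{ -I} - \varepsilon_{ -I}$; under the standing hypothesis $P_{ -I} = \varepsilon_{ -I} + \prod_{i\in I} p_i^{\alpha_{i,I}}$.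 For $\{i\}\in\mathcal D^{\mathrm{op}}$, $\alpha_i := \alpha_{i,\{i\}}$, so $P_{ -i} = p_i^{\alpha_i} + \varepsilon_{ -i}$ (when $I = S_n\setminus\{1\} \in \mathcal D$, $\alpha_1$ is thus defined). -}

module Defs where

open import Data.Nat using (ℕ; zero; suc; _*_; _^_)
open import Data.Nat.Divisibility using (_∣_)
open import Data.Bool using (Bool; true; false)
open import Data.Vec using (Vec; []; _∷_)
open import Data.Fin using (Fin; zero; suc)
open import Data.Fin.Subset using (Subset)
open import Data.Integer as ℤ using (ℤ; +_; _◃_)
open import Data.Sign using (Sign)
open import Data.Product using (_×_)
open import Relation.Nullary using (¬_)

prodSub : ∀ {n} → (Fin n → ℕ) → Subset n → ℕ
prodSub {zero}  f []          = 1
prodSub {suc n} f (true  ∷ I) = f zero * prodSub (λ i → f (suc i)) I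
prodSub {suc n} f (false ∷ I) = prodSub (λ i → f (suc i)) I

PP : ∀ {n} → (Fin n → ℕ) → (Fin n → ℕ) → Subset n → ℕ
PP p v I = prodSub (λ i → p i ^ v i) I

signℤ : Sign → ℤ
signℤ s = s ◃ 1

-- the positive integer P_I - ε_I (as a natural number, via absolute value)
shifted : ∀ {n} → (Fin n → ℕ) → (Fin n → ℕ) → (Subset n → Sign) → Subset n → ℕ
shifted p v ε I = ℤ.∣ (+ PP p v I) ℤ.- signℤ (ε I) ∣

IsExponent : ℕ → ℕ → ℕ → Set
IsExponent p m a = (p ^ a ∣ m) × ¬ (p ^ suc a ∣ m)

module Submission where

-- Indices start at 0 (p₀ is the smallest prime).  Write P_I for the product
-- ∏_{i ∈ I} p_i^{v_i} and N_I = |P_I − ε_I|.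
-- Since P_I ≥ 1, the numbers N_I and P_I are *adjacent* (they differ by exactly one);
-- hence no prime divides both, and one of them is even.
--
-- Part 1 (p₀ = 2).  If p₀ ≠ 2 then, the p_i being increasing, no p_i equals 2, so every
-- p_i is odd; then P_I is odd, N_I is even, and by hypothesis 2 = p_i for some i.
--
-- Part 2 (α₀ ≥ 4).  An (n−1)-subset avoiding 0 is I = ∁{0}; then Q = P_I is divisible by
-- every p_i with i ≥ 1, and Q ≥ p₁·p₂ ≥ 3·4.  Every prime factor of N = N_I is some p_i
-- by hypothesis, and adjacency rules out i ≥ 1, so 2 is its only prime factor.  Hence N
-- equals 2^a for its 2-adic exponent a, and 2^a = N ≥ Q − 1 ≥ 11 gives a ≥ 4.

open import Defs
open import Data.Nat using (ℕ; zero; suc; _≤_; _<_)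
open import Data.Nat.Primality using (Prime)
open import Data.Nat.Divisibility using (_∣_)
open import Data.Fin as Fin using (Fin; zero)
open import Data.Fin.Subset using (Subset; _∈_; _∉_; ∁; ⁅_⁆; ∣_∣; Nonempty)
open import Data.Sign using (Sign)
open import Data.Product using (Σ; ∃; _×_)
open import Relation.Binary.PropositionalEquality using (_≡_)

open import Data.Nat using (_*_; _^_; _∸_; z≤n; s≤s; _≟_; _≤?_; nonTrivial⇒n>1)
open import Data.Nat.Properties
  using (+-comm; *-comm; *-assoc; *-identityˡ; ≤-refl; ≤-trans; ≤-pred; ≤-reflexive; <-irrefl; ≰⇒>;
         n≤1+n; *-mono-≤; m^n≢0; ^-monoʳ-≤)
open import Data.Nat.Divisibility
  using (divides; ∣-trans; ∣⇒≤; ∣1⇒≡1; ∣m+n∣m⇒∣n; n∣m*n; m∣m*n)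
open import Data.Nat.Primality
  using (prime[2]; euclidsLemma; prime⇒irreducible; prime⇒nonZero; prime⇒nonTrivial)
open import Data.Nat.Primality.Factorisation using (factorise)
open import Data.Nat.ListAction using (product)
open import Data.List as List using ()
open import Data.List.Relation.Unary.All using (_∷_)
open import Data.Fin using (suc)
open import Data.Fin.Subset using (⊤; ⊥; inside; outside)
open import Data.Fin.Subset.Properties using (∣p∣≡n⇒p≡⊤; ∣∁p∣≡n∸∣p∣; ∣⊥∣≡0; ∉⊥; x∉p⇒x∈∁p)
open import Data.Vec using ([]; _∷_; here; there)
open import Data.Sign using () renaming (+ to plus; - to minus)
open import Data.Integer as ℤ using (+_)
open import Data.Product using (_,_)
open import Data.Sum using (_⊎_; inj₁; inj₂)
open import Data.Empty using (⊥-elim)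
open import Relation.Nullary using (¬_; yes; no; contradiction)
open import Relation.Nullary.Decidable using (from-no)
open import Relation.Binary.PropositionalEquality using (_≢_; refl; sym; trans; cong; subst)

Adjacent : ℕ → ℕ → Set
Adjacent x y = suc x ≡ y ⊎ x ≡ suc y

shift-adjacent : ∀ {P} (s : Sign) → 1 ≤ P → Adjacent ℤ.∣ (+ P) ℤ.- signℤ s ∣ P
shift-adjacent {suc P} plus  _ = inj₁ refl
shift-adjacent {suc P} minus _ = inj₂ (cong suc (+-comm P 1))

adjacent-lower : ∀ {x y} → Adjacent x y → y ≤ suc x
adjacent-lower (inj₁ refl) = ≤-refl
adjacent-lower {y = y} (inj₂ refl) = ≤-trans (n≤1+n y) (n≤1+n (suc y))

prime≥2 : ∀ {p} → Prime p → 2 ≤ p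
prime≥2 {p} pp = nonTrivial⇒n>1 p {{prime⇒nonTrivial pp}}

-- Adjacent numbers are coprime: a common divisor would divide their difference 1.
adjacent-coprime : ∀ {q x y} → Prime q → q ∣ x → q ∣ y → ¬ Adjacent x y
adjacent-coprime {q} {x} {y} pq q∣x q∣y adj =
  <-irrefl (sym (∣1⇒≡1 (divides-one adj))) (prime≥2 pq)
  where
    divides-one : Adjacent x y → q ∣ 1
    divides-one (inj₁ refl) = ∣m+n∣m⇒∣n (subst (q ∣_) (+-comm 1 x) q∣y) q∣x
    divides-one (inj₂ refl) = ∣m+n∣m⇒∣n (subst (q ∣_) (+-comm 1 y) q∣x) q∣y

even-or-next-even : ∀ x → (2 ∣ x) ⊎ (2 ∣ suc x)
even-or-next-even zero = inj₁ (divides 0 refl)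
even-or-next-even (suc x) with even-or-next-even x
... | inj₁ (divides c eq) = inj₂ (divides (suc c) (cong (λ z → suc (suc z)) eq))
... | inj₂ 2∣1+x          = inj₁ 2∣1+x

adjacent-even : ∀ {x y} → Adjacent x y → ¬ 2 ∣ y → 2 ∣ x
adjacent-even {x} (inj₁ refl) odd-y with even-or-next-even x
... | inj₁ 2∣x   = 2∣x
... | inj₂ 2∣1+x = contradiction 2∣1+x odd-y
adjacent-even {y = y} (inj₂ refl) odd-y with even-or-next-even y
... | inj₁ 2∣y   = contradiction 2∣y odd-y
... | inj₂ 2∣1+y = 2∣1+y

odd⇒positive : ∀ {x} → ¬ 2 ∣ x → 1 ≤ x
odd⇒positive {zero} odd-0 = contradiction (divides 0 refl) odd-0
odd⇒positive {suc x} _ = s≤s z≤n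

odd-prime : ∀ {p} → Prime p → p ≢ 2 → ¬ 2 ∣ p
odd-prime pp p≢2 2∣p with prime⇒irreducible pp 2∣p
... | inj₁ ()
... | inj₂ 2≡p = p≢2 (sym 2≡p)

prime∤^ : ∀ {q m} → Prime q → ¬ q ∣ m → ∀ v → ¬ q ∣ m ^ v
prime∤^ pq q∤m zero q∣1 = <-irrefl (sym (∣1⇒≡1 q∣1)) (prime≥2 pq)
prime∤^ {m = m} pq q∤m (suc v) q∣m^1+v with euclidsLemma m (m ^ v) pq q∣m^1+v
... | inj₁ q∣m   = q∤m q∣m
... | inj₂ q∣m^v = prime∤^ pq q∤m v q∣m^v

m∣m^v : ∀ m v → 1 ≤ v → m ∣ m ^ v
m∣m^v m (suc v) _ = m∣m*n (m ^ v)

prime-factor : ∀ k → ∃ λ r → Prime r × r ∣ suc (suc k)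
prime-factor k with factorise (suc (suc k))
... | record { factors = List.[] ; isFactorisation = () }
... | record { factors = r List.∷ rs ; isFactorisation = eq ; factorsPrime = pr ∷ _ } =
  r , pr , subst (r ∣_) (sym eq) (m∣m*n (product rs))

-- If q is the only prime factor of N > 0, then N is the power of q given by its q-adic
-- exponent: the cofactor N / q^a can have no prime factor, as q ∤ N / q^a.
sole-prime-power : ∀ {q N a} → 0 < N → (∀ r → Prime r → r ∣ N → r ≡ q)
  → IsExponent q N a → N ≡ q ^ a
sole-prime-power N>0 sole (divides zero eq , _) = contradiction (subst (0 <_) eq N>0) (λ ())
sole-prime-power {q} {a = a} N>0 sole (divides 1 eq , _) = trans eq (*-identityˡ (q ^ a))
sole-prime-power {q} {N} {a} N>0 sole (divides (suc (suc k)) eq , exact)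
  with prime-factor k
... | r , pr , r∣c with sole r pr (∣-trans r∣c (divides (q ^ a) (trans eq (*-comm _ (q ^ a)))))
... | refl = ⊥-elim (exact (one-more r∣c))
  where
    one-more : q ∣ suc (suc k) → q ^ suc a ∣ N
    one-more (divides c c≡cq) = divides c (trans eq (trans (cong (_* q ^ a) c≡cq) (*-assoc c q (q ^ a))))

exponent≥4 : ∀ a → 11 ≤ 2 ^ a → 4 ≤ a
exponent≥4 a 11≤2^a with 4 ≤? a
... | yes 4≤a = 4≤a
... | no 4≰a = contradiction (≤-trans 11≤2^a (^-monoʳ-≤ 2 (≤-pred (≰⇒> 4≰a)))) (from-no (11 ≤? 8))

prime∤prodSub : ∀ {n q} (f : Fin n → ℕ) → Prime q → (∀ i → ¬ q ∣ f i) → ∀ I → ¬ q ∣ prodSub f I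
prime∤prodSub f pq q∤f [] q∣1 = <-irrefl (sym (∣1⇒≡1 q∣1)) (prime≥2 pq)
prime∤prodSub f pq q∤f (inside ∷ I) q∣prod with euclidsLemma (f zero) _ pq q∣prod
... | inj₁ q∣f₀   = q∤f zero q∣f₀
... | inj₂ q∣rest = prime∤prodSub (λ i → f (suc i)) pq (λ i → q∤f (suc i)) I q∣rest
prime∤prodSub f pq q∤f (outside ∷ I) q∣rest = prime∤prodSub (λ i → f (suc i)) pq (λ i → q∤f (suc i)) I q∣rest

factor∣prodSub : ∀ {n} (f : Fin n → ℕ) {j} {I} → j ∈ I → f j ∣ prodSub f I
factor∣prodSub f here = m∣m*n _
factor∣prodSub f {I = inside ∷ I} (there j∈I) = ∣-trans (factor∣prodSub (λ i → f (suc i)) j∈I) (n∣m*n (f zero))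
factor∣prodSub f {I = outside ∷ I} (there j∈I) = factor∣prodSub (λ i → f (suc i)) j∈I

prodSub-positive : ∀ {n} (f : Fin n → ℕ) → (∀ i → 1 ≤ f i) → ∀ I → 1 ≤ prodSub f I
prodSub-positive f pos [] = s≤s z≤n
prodSub-positive f pos (inside ∷ I) = *-mono-≤ (pos zero) (prodSub-positive (λ i → f (suc i)) (λ i → pos (suc i)) I)
prodSub-positive f pos (outside ∷ I) = prodSub-positive (λ i → f (suc i)) (λ i → pos (suc i)) I

∁⊥≡⊤ : ∀ {n} → ∁ (⊥ {n}) ≡ ⊤
∁⊥≡⊤ {n} = ∣p∣≡n⇒p≡⊤ (trans (∣∁p∣≡n∸∣p∣ (⊥ {n})) (cong (n ∸_) (∣⊥∣≡0 n)))

avoiding-zero : ∀ {n} (I : Subset (suc n)) → zero ∉ I → ∣ I ∣ ≡ n → I ≡ ∁ ⁅ zero ⁆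
avoiding-zero (inside ∷ I) 0∉I _ = contradiction here 0∉I
avoiding-zero (outside ∷ I) _ ∣I∣≡n = cong (outside ∷_) (trans (∣p∣≡n⇒p≡⊤ ∣I∣≡n) (sym ∁⊥≡⊤))

increasing-avoids-2 : ∀ {n} (p : Fin (suc n) → ℕ) → (∀ i → Prime (p i)) → (∀ i j → i Fin.< j → p i < p j)
  → p zero ≢ 2 → ∀ i → p i ≢ 2
increasing-avoids-2 p pp inc p₀≢2 zero = p₀≢2
increasing-avoids-2 p pp inc p₀≢2 (suc j) pⱼ≡2 =
  <-irrefl refl (≤-trans (inc zero (suc j) (s≤s z≤n)) (≤-trans (≤-reflexive pⱼ≡2) (prime≥2 (pp zero))))

first-prime-is-2 : ∀ {n} (p : Fin (suc n) → ℕ) → (∀ i → Prime (p i)) → (∀ i j → i Fin.< j → p i < p j)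
  → ∀ v ε I → (∀ q → Prime q → q ∣ shifted p v ε I → ∃ λ i → q ≡ p i) → p zero ≡ 2
first-prime-is-2 p pp inc v ε I factors-in with p zero ≟ 2
... | yes p₀≡2 = p₀≡2
... | no p₀≢2 = ⊥-elim (2-not-among (factors-in 2 prime[2] N-even))
  where
    2-not-among : ¬ ∃ λ i → 2 ≡ p i
    2-not-among (i , 2≡pᵢ) = increasing-avoids-2 p pp inc p₀≢2 i (sym 2≡pᵢ)
    P-odd : ¬ 2 ∣ PP p v I
    P-odd = prime∤prodSub _ prime[2]
      (λ i → prime∤^ prime[2] (odd-prime (pp i) (increasing-avoids-2 p pp inc p₀≢2 i)) (v i)) I
    N-even : 2 ∣ shifted p v ε I
    N-even = adjacent-even (shift-adjacent (ε I) (odd⇒positive P-odd)) P-odd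

exponent-of-2≥4 : ∀ k (p : Fin (suc (suc (suc k))) → ℕ) → (∀ i → Prime (p i))
  → (∀ i j → i Fin.< j → p i < p j) → p zero ≡ 2 → ∀ v → (∀ i → 1 ≤ v i) → ∀ ε
  → (∀ q → Prime q → q ∣ shifted p v ε (∁ ⁅ zero ⁆) → ∃ λ i → q ≡ p i)
  → ∀ a → IsExponent 2 (shifted p v ε (∁ ⁅ zero ⁆)) a → 4 ≤ a
exponent-of-2≥4 k p pp inc p₀≡2 v v≥1 ε factors-in a exponent =
  exponent≥4 a (subst (11 ≤_) (sole-prime-power {a = a} N>0 only-2 exponent) N≥11)
  where
    J : Subset (suc (suc (suc k)))
    J = ∁ ⁅ zero ⁆
    N Q : ℕ
    N = shifted p v ε J
    Q = PP p v J

    p∣factor : ∀ i → p i ∣ p i ^ v i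
    p∣factor i = m∣m^v (p i) (v i) (v≥1 i)
    p≤factor : ∀ i → p i ≤ p i ^ v i
    p≤factor i = ∣⇒≤ {{m^n≢0 (p i) (v i) {{prime⇒nonZero (pp i)}}}} (p∣factor i)

    p₁≥3 : 3 ≤ p (suc zero)
    p₁≥3 = subst (_< p (suc zero)) p₀≡2 (inc zero (suc zero) (s≤s z≤n))
    p₂≥4 : 4 ≤ p (suc (suc zero))
    p₂≥4 = ≤-trans (s≤s p₁≥3) (inc (suc zero) (suc (suc zero)) (s≤s (s≤s z≤n)))

    -- Q = p₁^v₁ · p₂^v₂ · (a positive product)
    Q≥12 : 12 ≤ Q
    Q≥12 = *-mono-≤ {3} {_} {4} (≤-trans p₁≥3 (p≤factor (suc zero)))
             (*-mono-≤ (≤-trans p₂≥4 (p≤factor (suc (suc zero))))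
               (prodSub-positive (λ i → p (suc (suc (suc i))) ^ v (suc (suc (suc i))))
                 (λ i → ≤-trans (s≤s z≤n) (≤-trans (prime≥2 (pp _)) (p≤factor (suc (suc (suc i))))))
                 (∁ ⊥)))

    p∣Q : ∀ j → p (suc j) ∣ Q
    p∣Q j = ∣-trans (p∣factor (suc j))
      (factor∣prodSub (λ i → p i ^ v i) {I = J} (x∉p⇒x∈∁p λ { (there j∈⊥) → ∉⊥ j∈⊥ }))

    adjacent : Adjacent N Q
    adjacent = shift-adjacent (ε J) (≤-trans (s≤s z≤n) Q≥12)
    N≥11 : 11 ≤ N
    N≥11 = ≤-pred (≤-trans Q≥12 (adjacent-lower adjacent))
    N>0 : 0 < N
    N>0 = ≤-trans (s≤s z≤n) N≥11

    -- a prime factor p_{j+1} of N would also divide the adjacent number Q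
    only-2 : ∀ r → Prime r → r ∣ N → r ≡ 2
    only-2 r pr r∣N with factors-in r pr r∣N
    ... | zero , r≡p₀ = trans r≡p₀ p₀≡2
    ... | suc j , r≡pⱼ = ⊥-elim (adjacent-coprime pr r∣N (subst (_∣ Q) (sym r≡pⱼ) (p∣Q j)) adjacent)

lemma2 : (m : ℕ) → 3 ≤ suc m
  → (p : Fin (suc m) → ℕ) → (∀ i → Prime (p i)) → (∀ i j → i Fin.< j → p i < p j)
  → (v : Fin (suc m) → ℕ) → (∀ i → 1 ≤ v i)
  → (D : Subset (suc m) → Set)
  → (∀ I → D I → Nonempty I × Nonempty (∁ I))
  → (∃ λ I → D I)
  → (ε : Subset (suc m) → Sign)
  → (∀ I → D I → ∀ q → Prime q → q ∣ shifted p v ε I → ∃ λ i → q ≡ p i)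
  → ∀ I → D I → zero ∉ I
  → (p zero ≡ 2)
    × (∣ I ∣ ≡ m
       → ∀ a → IsExponent (p zero) (shifted p v ε (∁ ⁅ zero ⁆)) a → 4 ≤ a)
lemma2 zero (s≤s ())
lemma2 (suc zero) (s≤s (s≤s ()))
lemma2 (suc (suc k)) _ p pp inc v v≥1 D _ _ ε factors-in I I∈D 0∉I = p₀≡2 , exponent≥4-at-p₀
  where
    p₀≡2 : p zero ≡ 2
    p₀≡2 = first-prime-is-2 p pp inc v ε I (factors-in I I∈D)

    exponent≥4-at-p₀ : ∣ I ∣ ≡ suc (suc k)
      → ∀ a → IsExponent (p zero) (shifted p v ε (∁ ⁅ zero ⁆)) a → 4 ≤ a
    exponent≥4-at-p₀ ∣I∣≡m a exponent =
      exponent-of-2≥4 k p pp inc p₀≡2 v v≥1 ε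
        (factors-in (∁ ⁅ zero ⁆) (subst D (avoiding-zero I 0∉I ∣I∣≡m) I∈D)) a
        (subst (λ q → IsExponent q (shifted p v ε (∁ ⁅ zero ⁆)) a) p₀≡2 exponent)
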